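{- Let there be a derivation in system $\mathcal{V}$ of $\Gamma\vdash^{(m,e,s)} t:\tau$, and let $v$ be a value with a derivation in system $\mathcal{V}$ of $\Delta\vdash^{(m',e',s')} v:\Gamma(x)$. Then there is a derivation in system $\mathcal{V}$ of $(\Gamma\setminus\!\!\setminus x)+\Delta\vdash^{(m+m',\,e+e'-1,\,s+s')} t\{x:=v\}:\tau$.
   Context: Terms are $t,u,r ::= x \mid \lambda x.t \mid t\,u \mid t[x\backslash u]$ over a countably infinite set of variables, where $t[x\backslash u]$ (explicit substitution) binds $x$ in $t$; terms are taken modulo $\alpha$-conversion and $t\{x:=v\}$ denotes capture-avoiding meta-level substitution. Values are $v ::= x \mid \lambda x.t$. Types. Tight types: $\mathtt{tt} ::= \mathtt{n} \mid \mathtt{vl} \mid \mathtt{vr}$. Types $\sigma,\tau ::= \mathtt{tt}\mid\mathcal{M}\mid\mathcal{M}\to\sigma$, with multitypes $\mathcal{M}=[\sigma_i]_{i\in I}$ finite multisets of types ($[\,]$ empty, $\sqcup$ union). Typing contexts $\Gamma$ map variables to multitypes, $[\,]$ for all but finitely many; $(\Gamma+\Delta)(x)=\Gamma(x)\sqcup\Delta(x)$, extended to finite sums; $\Gamma\setminus\!\!\setminus x$ maps $x$ to $[\,]$ and agrees with $\Gamma$ elsewhere. Judgements $\Gamma\vdash^{(m,e,s)} t:\sigma$ carry integer counters. System $\mathcal{V}$ has the rules: (var$_p$) $x:[\mathtt{vr}]\vdash^{(0,0,0)} x:\mathtt{vr}$; (val$_p$) $\emptyset\vdash^{(0,0,0)}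 x:\mathtt{vl}$; (abs$_p$) $\emptyset\vdash^{(0,0,0)}\lambda x.t:\mathtt{vl}$; (app$_p$) from $\Gamma\vdash^{(m,e,s)} t:\mathtt{tt}_1$ with $\mathtt{tt}_1\in\{\mathtt{vr},\mathtt{n}\}$ and $\Delta\vdash^{(m',e',s')} u:\mathtt{tt}_2$ with $\mathtt{tt}_2\in\{\mathtt{vl},\mathtt{n}\}$, infer $\Gamma+\Delta\vdash^{(m+m',e+e',s+s'+1)} t\,u:\mathtt{n}$; (es$_p$) from $\Gamma\vdash^{(m,e,s)} t:\tau$, $\Delta\vdash^{(m',e',s')} u:\mathtt{n}$ and $\Gamma(x)$ tight, infer $(\Gamma\setminus\!\!\setminus x)+\Delta\vdash^{(m+m',e+e',s+s')} t[x\backslash u]:\tau$; (var$_c$) $x:\mathcal{M}\vdash^{(0,1,0)} x:\mathcal{M}$ for any multitype $\mathcal{M}$; (app$_c$) from $\Gamma\vdash^{(m,e,s)} t:[\mathcal{M}\to\tau]$ and $\Delta\vdash^{(m',e',s')} u:\mathcal{M}$, infer $\Gamma+\Delta\vdash^{(m+m'+1,e+e'-1,s+s')} t\,u:\tau$; (appt$_c$) from $\Gamma\vdash^{(m,e,s)} t:[\mathcal{M}\to\tau]$, $\Delta\vdash^{(m',e',s')} u:\mathtt{n}$ and $\mathcal{M}$ tight, infer $\Gamma+\Delta\vdash^{(m+m'+1,e+e'-1,s+s')} t\,u:\tau$; (abs$_c$) from $\Gamma_i\vdash^{(m_i,e_i,s_i)} t:\tau_i$ for each $i\in I$ ($I$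 finite, possibly empty), infer $+_{i\in I}(\Gamma_i\setminus\!\!\setminus x)\vdash^{(\sum_i m_i,\,1+\sum_i e_i,\,\sum_i s_i)}\lambda x.t:[\Gamma_i(x)\to\tau_i]_{i\in I}$; (es$_c$) from $\Gamma\vdash^{(m,e,s)} t:\sigma$ and $\Delta\vdash^{(m',e',s')} u:\Gamma(x)$, infer $(\Gamma\setminus\!\!\setminus x)+\Delta\vdash^{(m+m',e+e',s+s')} t[x\backslash u]:\sigma$. A multitype is tight if all its elements are tight types. -}

module Defs where

open import Data.Nat using (ℕ; zero; suc; _≟_; _<?_)
open import Data.Integer using (ℤ; 0ℤ; 1ℤ; _+_)
open import Data.List using (List; []; _∷_; _++_; [_]; tabulate)
open import Data.List.Relation.Unary.All using (All)
open import Data.Fin using (Fin)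
open import Relation.Nullary using (yes; no)

-- Terms, in de Bruijn notation (terms modulo α-conversion).
--   var y      : variable (index y)
--   lam t      : λ-abstraction, binds index 0 in t
--   app t u    : application
--   es t u     : explicit substitution t[0\u], binds index 0 in t

data Tm : Set where
  var : ℕ → Tm
  lam : Tm → Tm
  app : Tm → Tm → Tm
  es  : Tm → Tm → Tm

data IsValue : Tm → Set where
  val-var : ∀ y → IsValue (var y)
  val-lam : ∀ t → IsValue (lam t)

shift : ℕ → Tm → Tm
shift c (var y) with y <? c
... | yes _ = var y
... | no  _ = var (suc y)
shift c (lam t)   = lam (shift (suc c) t)
shift c (app t u) = app (shift c t) (shift c u)
shift c (es t u)  = es (shift (suc c) t) (shift c u)

-- capture-avoiding meta-level substitution t{x:=v}: replaces the free
-- variable x by v, leaving all other free variables unchanged.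
sub : ℕ → Tm → Tm → Tm
sub x v (var y) with y ≟ x
... | yes _ = v
... | no  _ = var y
sub x v (lam t)   = lam (sub (suc x) (shift 0 v) t)
sub x v (app t u) = app (sub x v t) (sub x v u)
sub x v (es t u)  = es (sub (suc x) (shift 0 v) t) (sub x v u)

-- Types.  Multitypes are finite multisets, represented by lists taken
-- up to the equivalence _≈M_ below.

data Ty : Set where
  tn tvl tvr : Ty
  mt  : List Ty → Ty
  _⇒_ : List Ty → Ty → Ty

MTy : Set
MTy = List Ty

data Tight : Ty → Set where
  tight-n  : Tight tn
  tight-vl : Tight tvl
  tight-vr : Tight tvr

TightM : MTy → Set
TightM M = All Tight M

mutual
  data _≈T_ : Ty → Ty → Set where
    ≈n   : tn ≈T tn
    ≈vl  : tvl ≈T tvl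
    ≈vr  : tvr ≈T tvr
    ≈mt  : ∀ {M N} → M ≈M N → mt M ≈T mt N
    ≈arr : ∀ {M N σ τ} → M ≈M N → σ ≈T τ → (M ⇒ σ) ≈T (N ⇒ τ)

  data _≈M_ : MTy → MTy → Set where
    ≈[]  : [] ≈M []
    ≈ins : ∀ {a b M N₁ N₂} → a ≈T b → M ≈M (N₁ ++ N₂) →
           (a ∷ M) ≈M (N₁ ++ b ∷ N₂)

Ctx : Set
Ctx = ℕ → MTy

∅ : Ctx
∅ _ = []

_+C_ : Ctx → Ctx → Ctx
(Γ +C Δ) y = Γ y ++ Δ y

⟨_∶_⟩ : ℕ → MTy → Ctx
⟨ x ∶ M ⟩ y with y ≟ x
... | yes _ = M
... | no  _ = []

_∖∖_ : Ctx → ℕ → Ctx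
(Γ ∖∖ x) y with y ≟ x
... | yes _ = []
... | no  _ = Γ y

-- removing the variable bound by a binder (index 0) and moving outward
under : Ctx → Ctx
under Γ y = Γ (suc y)

_≈C_ : Ctx → Ctx → Set
Γ ≈C Δ = ∀ y → Γ y ≈M Δ y

sumℤ : ∀ {k} → (Fin k → ℤ) → ℤ
sumℤ {zero}  f = 0ℤ
sumℤ {suc k} f = f Fin.zero + sumℤ (λ i → f (Fin.suc i))

sumC : ∀ {k} → (Fin k → Ctx) → Ctx
sumC {zero}  f = ∅
sumC {suc k} f = f Fin.zero +C sumC (λ i → f (Fin.suc i))

-- System V.   Der Γ t σ m e s   means   Γ ⊢^(m,e,s) t : σ.

data HeadTT : Ty → Set where
  h-vr : HeadTT tvr
  h-n  : HeadTT tn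

data ArgTT : Ty → Set where
  a-vl : ArgTT tvl
  a-n  : ArgTT tn

data Der : Ctx → Tm → Ty → ℤ → ℤ → ℤ → Set where
  var-p : ∀ x → Der ⟨ x ∶ [ tvr ] ⟩ (var x) tvr 0ℤ 0ℤ 0ℤ
  val-p : ∀ x → Der ∅ (var x) tvl 0ℤ 0ℤ 0ℤ
  abs-p : ∀ t → Der ∅ (lam t) tvl 0ℤ 0ℤ 0ℤ
  app-p : ∀ {Γ Δ t u τ₁ τ₂ m e s m' e' s'} →
          Der Γ t τ₁ m e s → HeadTT τ₁ →
          Der Δ u τ₂ m' e' s' → ArgTT τ₂ →
          Der (Γ +C Δ) (app t u) tn (m + m') (e + e') (s + s' + 1ℤ)
  es-p  : ∀ {Γ Δ t u τ m e s m' e' s'} →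
          Der Γ t τ m e s → Der Δ u tn m' e' s' → TightM (Γ 0) →
          Der (under Γ +C Δ) (es t u) τ (m + m') (e + e') (s + s')
  var-c : ∀ x M → Der ⟨ x ∶ M ⟩ (var x) (mt M) 0ℤ 1ℤ 0ℤ
  app-c : ∀ {Γ Δ t u M τ m e s m' e' s'} →
          Der Γ t (mt [ M ⇒ τ ]) m e s → Der Δ u (mt M) m' e' s' →
          Der (Γ +C Δ) (app t u) τ (m + m' + 1ℤ) (e + e' + Data.Integer.-_ 1ℤ) (s + s')
  appt-c : ∀ {Γ Δ t u M τ m e s m' e' s'} →
          Der Γ t (mt [ M ⇒ τ ]) m e s → Der Δ u tn m' e' s' → TightM M →
          Der (Γ +C Δ) (app t u) τ (m + m' + 1ℤ) (e + e' + Data.Integer.-_ 1ℤ) (s + s')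
  abs-c : ∀ {k t} (Γs : Fin k → Ctx) (τs : Fin k → Ty) (ms es ss : Fin k → ℤ) →
          (∀ i → Der (Γs i) t (τs i) (ms i) (es i) (ss i)) →
          Der (sumC (λ i → under (Γs i))) (lam t)
              (mt (tabulate (λ i → Γs i 0 ⇒ τs i)))
              (sumℤ ms) (1ℤ + sumℤ es) (sumℤ ss)
  es-c  : ∀ {Γ Δ t u σ m e s m' e' s'} →
          Der Γ t σ m e s → Der Δ u (mt (Γ 0)) m' e' s' →
          Der (under Γ +C Δ) (es t u) σ (m + m') (e + e') (s + s')
  -- multitypes are multisets: derivations are on equivalence classes
  conv  : ∀ {Γ Γ' t σ σ' m e s} → Γ ≈C Γ' → σ ≈T σ' →
          Der Γ t σ m e s → Der Γ' t σ' m e s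

-- Induction on the derivation of t, for all x, v and Δ at once: every rule of the system
-- preserves the substitution property (Substitutive). The typing of v at the multitype Γ x
-- is distributed over the premises: a typing of a value at M ++ N splits into typings at M
-- and at N whose contexts and counters add up, except that each part carries its own
-- (var_c) or (abs_c) step in e, whence the e + e' - 1. At an occurrence of x the typing
-- of v is used as it is (var_c) or collapsed to vr (var_p); where Γ x is empty, v is typed
-- with the empty multitype at cost (0, 1, 0). Since multitypes are lists up to
-- permutation, a λ typed at a multitype is first inverted into the list of its body
-- typings, which can be reordered before it is split.
module Submission where

open import Defs
open import Algebra.Bundles using (CommutativeMonoid)
import Algebra.Construct.Pointwise as Pointwise
import Algebra.Properties.CommutativeSemigroup as CommutativeSemigroupProperties
open import Data.Integer using (ℤ; _+_; _-_; -_; 1ℤ; 0ℤ)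
import Data.Integer.Properties as ℤ
open import Data.Integer.Tactic.RingSolver using (solve-∀)
open import Data.Fin using (Fin; zero; suc)
open import Data.List using (List; []; _∷_; _++_; [_]; tabulate)
open import Data.List.Properties using (++-assoc; ++-identityʳ; ∷-injective; tabulate-cong)
open import Data.Nat using (ℕ; zero; suc; _≟_; _<?_; _<_; s≤s; z≤n)
open import Data.Nat.Properties using (suc-injective)
open import Data.Product using (Σ-syntax; _×_; _,_)
import Data.Vec.Functional as Vec
open import Level using (0ℓ)
open import Relation.Binary.PropositionalEquality
  using (_≡_; _≢_; refl; sym; trans; cong; cong₂; subst; module ≡-Reasoning)
import Relation.Binary.Reasoning.Setoid as SetoidReasoning
open import Relation.Nullary using (Dec; yes; no; ¬_)
open import Data.Empty using (⊥; ⊥-elim)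

private
  variable
    A : Set
    M M' N N' P : MTy
    σ σ' τ : Ty
    Γ Γ' Δ Δ' : Ctx
    K K' : MTy
    t v : Tm
    k : ℕ
    m e s m' e' s' : ℤ

mutual
  ≈T-refl : σ ≈T σ
  ≈T-refl {tn}    = ≈n
  ≈T-refl {tvl}   = ≈vl
  ≈T-refl {tvr}   = ≈vr
  ≈T-refl {mt M}  = ≈mt ≈M-refl
  ≈T-refl {M ⇒ σ} = ≈arr ≈M-refl ≈T-refl

  ≈M-refl : M ≈M M
  ≈M-refl {[]}    = ≈[]
  ≈M-refl {σ ∷ M} = ≈ins {N₁ = []} ≈T-refl ≈M-refl

≈M-reflexive : M ≡ N → M ≈M N
≈M-reflexive refl = ≈M-refl

≈M-shift : ∀ N₁ {N₂} → σ ≈T τ → (N₁ ++ N₂) ≈M M → (N₁ ++ σ ∷ N₂) ≈M (τ ∷ M)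
≈M-shift           []       σ≈τ p                      = ≈ins {N₁ = []} σ≈τ p
≈M-shift {τ = τ} (ν ∷ N₁) σ≈τ (≈ins {N₁ = P₁} ν≈ p) = ≈ins {N₁ = τ ∷ P₁} ν≈ (≈M-shift N₁ σ≈τ p)

mutual
  ≈T-sym : σ ≈T τ → τ ≈T σ
  ≈T-sym ≈n         = ≈n
  ≈T-sym ≈vl        = ≈vl
  ≈T-sym ≈vr        = ≈vr
  ≈T-sym (≈mt p)    = ≈mt (≈M-sym p)
  ≈T-sym (≈arr p q) = ≈arr (≈M-sym p) (≈T-sym q)

  ≈M-sym : M ≈M N → N ≈M M
  ≈M-sym ≈[]                    = ≈[]
  ≈M-sym (≈ins {N₁ = N₁} σ≈ p) = ≈M-shift N₁ (≈T-sym σ≈) (≈M-sym p)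

record Reinsertion (P₁ P₂ Q₁ Q₂ : List A) (x y : A) : Set where
  constructor reinsertion
  field
    L₁ L₂ R₁ R₂ : List A
    at-x  : P₁ ++ y ∷ P₂ ≡ L₁ ++ x ∷ L₂
    at-y  : L₁ ++ L₂ ≡ R₁ ++ y ∷ R₂
    equal : R₁ ++ R₂ ≡ Q₁ ++ Q₂

insert-remove : ∀ (P₁ P₂ Q₁ Q₂ : List A) x y → P₁ ++ P₂ ≡ Q₁ ++ x ∷ Q₂ → Reinsertion P₁ P₂ Q₁ Q₂ x y
insert-remove []       P₂ Q₁       Q₂ x y eq =
  reinsertion (y ∷ Q₁) Q₂ [] (Q₁ ++ Q₂) (cong (y ∷_) eq) refl refl
insert-remove (p ∷ P₁) P₂ []       Q₂ x y eq with ∷-injective eq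
... | refl , eq′ = reinsertion [] (P₁ ++ y ∷ P₂) P₁ P₂ refl refl eq′
insert-remove (p ∷ P₁) P₂ (q ∷ Q₁) Q₂ x y eq with ∷-injective eq
... | refl , eq′ with insert-remove P₁ P₂ Q₁ Q₂ x y eq′
... | reinsertion L₁ L₂ R₁ R₂ at-x at-y equal =
  reinsertion (p ∷ L₁) L₂ (p ∷ R₁) R₂ (cong (p ∷_) at-x) (cong (p ∷_) at-y) (cong (p ∷_) equal)

record Extraction (N₁ N₂ : MTy) (σ : Ty) (P : MTy) : Set where
  constructor extraction
  field
    P₁ P₂ : MTy
    ρ     : Ty
    P≡    : P ≡ P₁ ++ ρ ∷ P₂
    σ≈ρ   : σ ≈T ρ
    rest  : (N₁ ++ N₂) ≈M (P₁ ++ P₂)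

≈M-extract : ∀ N₁ {N₂} → (N₁ ++ σ ∷ N₂) ≈M P → Extraction N₁ N₂ σ P
≈M-extract []       (≈ins {N₁ = P₁} {N₂ = P₂} σ≈ p) = extraction P₁ P₂ _ refl σ≈ p
≈M-extract (ν ∷ N₁) (≈ins {N₁ = P₁} {N₂ = P₂} ν≈ p) with ≈M-extract N₁ p
... | extraction Q₁ Q₂ ρ eq σ≈ρ rest with insert-remove P₁ P₂ Q₁ Q₂ ρ _ eq
... | reinsertion L₁ L₂ R₁ R₂ at-x at-y equal =
  extraction L₁ L₂ ρ at-x σ≈ρ
    (subst (_ ≈M_) (sym at-y) (≈ins {N₁ = R₁} ν≈ (subst (_ ≈M_) (sym equal) rest)))

mutual
  ≈T-trans : σ ≈T σ' → σ' ≈T τ → σ ≈T τ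
  ≈T-trans ≈n          ≈n          = ≈n
  ≈T-trans ≈vl         ≈vl         = ≈vl
  ≈T-trans ≈vr         ≈vr         = ≈vr
  ≈T-trans (≈mt p)     (≈mt q)     = ≈mt (≈M-trans p q)
  ≈T-trans (≈arr p p′) (≈arr q q′) = ≈arr (≈M-trans p q) (≈T-trans p′ q′)

  ≈M-trans : M ≈M N → N ≈M P → M ≈M P
  ≈M-trans ≈[]                    q = q
  ≈M-trans (≈ins {N₁ = N₁} σ≈ p) q with ≈M-extract N₁ q
  ... | extraction P₁ P₂ ρ refl σ≈ρ rest = ≈ins (≈T-trans σ≈ σ≈ρ) (≈M-trans p rest)

++-≈M-cong : M ≈M M' → N ≈M N' → (M ++ N) ≈M (M' ++ N')
++-≈M-cong ≈[]                                       q = q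
++-≈M-cong {N' = N'} (≈ins {N₁ = P₁} {N₂ = P₂} σ≈ p) q =
  subst (_ ≈M_) (sym (++-assoc P₁ _ N')) (≈ins σ≈ (subst (_ ≈M_) (++-assoc P₁ P₂ N') (++-≈M-cong p q)))

++-≈M-comm : ∀ M N → (M ++ N) ≈M (N ++ M)
++-≈M-comm []      N = ≈M-reflexive (sym (++-identityʳ N))
++-≈M-comm (σ ∷ M) N = ≈ins {N₁ = N} ≈T-refl (++-≈M-comm M N)

multitypes : CommutativeMonoid 0ℓ 0ℓ
multitypes = record
  { Carrier             = MTy
  ; _≈_                 = _≈M_
  ; _∙_                 = _++_
  ; ε                   = []
  ; isCommutativeMonoid = record
    { isMonoid = record
      { isSemigroup = record
        { isMagma = record
          { isEquivalence = record { refl = ≈M-refl ; sym = ≈M-sym ; trans = ≈M-trans }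
          ; ∙-cong        = ++-≈M-cong
          }
        ; assoc = λ M N P → ≈M-reflexive (++-assoc M N P)
        }
      ; identity = (λ M → ≈M-refl) , (λ M → ≈M-reflexive (++-identityʳ M))
      }
    ; comm = ++-≈M-comm
    }
  }

contexts : CommutativeMonoid 0ℓ 0ℓ
contexts = Pointwise.commutativeMonoid ℕ multitypes

open CommutativeMonoid contexts public
  using ()
  renaming ( refl to ≈C-refl; sym to ≈C-sym; trans to ≈C-trans; reflexive to ≈C-reflexive
           ; ∙-cong to +C-cong; assoc to +C-assoc; identityʳ to +C-identityʳ )
open CommutativeSemigroupProperties (CommutativeMonoid.commutativeSemigroup contexts) public
  using () renaming (interchange to +C-interchange; x∙yz≈y∙xz to +C-left-comm)
open CommutativeSemigroupProperties ℤ.+-commutativeSemigroup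
  using () renaming (x∙yz≈y∙xz to +-left-comm; interchange to +-interchange)

⟨⟩-self : ∀ x M → ⟨ x ∶ M ⟩ x ≡ M
⟨⟩-self x M with x ≟ x
... | yes _   = refl
... | no  x≢x = ⊥-elim (x≢x refl)

⟨⟩-other : ∀ x M y → y ≢ x → ⟨ x ∶ M ⟩ y ≡ []
⟨⟩-other x M y y≢x with y ≟ x
... | yes y≡x = ⊥-elim (y≢x y≡x)
... | no  _   = refl

⟨⟩-cong : ∀ x → M ≈M N → ⟨ x ∶ M ⟩ ≈C ⟨ x ∶ N ⟩
⟨⟩-cong x M≈N y with y ≟ x
... | yes _ = M≈N
... | no  _ = ≈[]

⟨⟩-++ : ∀ x M N → ⟨ x ∶ M ++ N ⟩ ≈C (⟨ x ∶ M ⟩ +C ⟨ x ∶ N ⟩)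
⟨⟩-++ x M N y with y ≟ x
... | yes _ = ≈M-refl
... | no  _ = ≈[]

⟨⟩-[] : ∀ x → ⟨ x ∶ [] ⟩ ≈C ∅
⟨⟩-[] x y with y ≟ x
... | yes _ = ≈[]
... | no  _ = ≈[]

∖∖-self : ∀ Γ x → (Γ ∖∖ x) x ≡ []
∖∖-self Γ x with x ≟ x
... | yes _   = refl
... | no  x≢x = ⊥-elim (x≢x refl)

∖∖-other : ∀ Γ x y → y ≢ x → (Γ ∖∖ x) y ≡ Γ y
∖∖-other Γ x y y≢x with y ≟ x
... | yes y≡x = ⊥-elim (y≢x y≡x)
... | no  _   = refl

∖∖-cong : ∀ x → Γ ≈C Γ' → (Γ ∖∖ x) ≈C (Γ' ∖∖ x)
∖∖-cong x Γ≈Γ' y with y ≟ x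
... | yes _ = ≈[]
... | no  _ = Γ≈Γ' y

∖∖-+ : ∀ Γ Δ x → ((Γ +C Δ) ∖∖ x) ≈C ((Γ ∖∖ x) +C (Δ ∖∖ x))
∖∖-+ Γ Δ x y with y ≟ x
... | yes _ = ≈[]
... | no  _ = ≈M-refl

∖∖-unused : ∀ Γ x → Γ x ≡ [] → (Γ ∖∖ x) ≈C Γ
∖∖-unused Γ x Γx≡[] y with y ≟ x
... | yes refl = ≈M-reflexive (sym Γx≡[])
... | no  _    = ≈M-refl

⟨⟩-∖∖ : ∀ x M → (⟨ x ∶ M ⟩ ∖∖ x) ≈C ∅
⟨⟩-∖∖ x M y with y ≟ x
... | yes _   = ≈[]
... | no  y≢x = ≈M-reflexive (⟨⟩-other x M y y≢x)

under-∖∖ : ∀ Γ x → under (Γ ∖∖ suc x) ≈C (under Γ ∖∖ x)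
under-∖∖ Γ x y with y ≟ x
... | yes refl = ≈M-reflexive (∖∖-self Γ (suc y))
... | no  y≢x  = ≈M-reflexive (∖∖-other Γ (suc x) (suc y) (λ eq → y≢x (suc-injective eq)))

shiftVar : ℕ → ℕ → ℕ
shiftVar zero    y       = suc y
shiftVar (suc c) zero    = zero
shiftVar (suc c) (suc y) = suc (shiftVar c y)

shiftVar-< : ∀ c y → y < c → shiftVar c y ≡ y
shiftVar-< (suc c) zero    _         = refl
shiftVar-< (suc c) (suc y) (s≤s y<c) = cong suc (shiftVar-< c y y<c)

shiftVar-≮ : ∀ c y → ¬ y < c → shiftVar c y ≡ suc y
shiftVar-≮ zero    y       _   = refl
shiftVar-≮ (suc c) zero    y≮c = ⊥-elim (y≮c (s≤s z≤n))
shiftVar-≮ (suc c) (suc y) y≮c = cong suc (shiftVar-≮ c y (λ y<c → y≮c (s≤s y<c)))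

shift-var : ∀ c y → shift c (var y) ≡ var (shiftVar c y)
shift-var c y with y <? c
... | yes y<c = cong var (sym (shiftVar-< c y y<c))
... | no  y≮c = cong var (sym (shiftVar-≮ c y y≮c))

shift-value : ∀ c {v} → IsValue v → IsValue (shift c v)
shift-value c (val-var y) rewrite shift-var c y = val-var _
shift-value c (val-lam t)                      = val-lam _

-- The context of shift c t: an unused variable is inserted at index c.
shiftCtx : ℕ → Ctx → Ctx
shiftCtx zero    Γ zero    = []
shiftCtx zero    Γ (suc y) = Γ y
shiftCtx (suc c) Γ zero    = Γ zero
shiftCtx (suc c) Γ (suc y) = shiftCtx c (under Γ) y

shiftCtx-cong : ∀ c → Γ ≈C Γ' → shiftCtx c Γ ≈C shiftCtx c Γ'
shiftCtx-cong zero    Γ≈Γ' zero    = ≈[]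
shiftCtx-cong zero    Γ≈Γ' (suc y) = Γ≈Γ' y
shiftCtx-cong (suc c) Γ≈Γ' zero    = Γ≈Γ' zero
shiftCtx-cong (suc c) Γ≈Γ' (suc y) = shiftCtx-cong c (λ z → Γ≈Γ' (suc z)) y

shiftCtx-+ : ∀ c Γ Δ → shiftCtx c (Γ +C Δ) ≈C (shiftCtx c Γ +C shiftCtx c Δ)
shiftCtx-+ zero    Γ Δ zero    = ≈[]
shiftCtx-+ zero    Γ Δ (suc y) = ≈M-refl
shiftCtx-+ (suc c) Γ Δ zero    = ≈M-refl
shiftCtx-+ (suc c) Γ Δ (suc y) = shiftCtx-+ c (under Γ) (under Δ) y

shiftCtx-∅ : ∀ c → shiftCtx c ∅ ≈C ∅
shiftCtx-∅ zero    zero    = ≈[]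
shiftCtx-∅ zero    (suc y) = ≈[]
shiftCtx-∅ (suc c) zero    = ≈[]
shiftCtx-∅ (suc c) (suc y) = shiftCtx-∅ c y

shiftCtx-sumC : ∀ c {k} (Γs : Fin k → Ctx) → shiftCtx c (sumC Γs) ≈C sumC (λ i → shiftCtx c (Γs i))
shiftCtx-sumC c {zero}  Γs = shiftCtx-∅ c
shiftCtx-sumC c {suc k} Γs =
  ≈C-trans (shiftCtx-+ c (Γs zero) _) (+C-cong ≈C-refl (shiftCtx-sumC c (λ i → Γs (suc i))))

⟨⟩-suc : ∀ x M y → ⟨ suc x ∶ M ⟩ (suc y) ≡ ⟨ x ∶ M ⟩ y
⟨⟩-suc x M y = by-cases (y ≟ x)
  where
  by-cases : Dec (y ≡ x) → ⟨ suc x ∶ M ⟩ (suc y) ≡ ⟨ x ∶ M ⟩ y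
  by-cases (yes refl) = trans (⟨⟩-self (suc y) M) (sym (⟨⟩-self y M))
  by-cases (no  y≢x)  =
    trans (⟨⟩-other (suc x) M (suc y) (λ eq → y≢x (suc-injective eq))) (sym (⟨⟩-other x M y y≢x))

shiftCtx-⟨⟩ : ∀ c x M → shiftCtx c ⟨ x ∶ M ⟩ ≈C ⟨ shiftVar c x ∶ M ⟩
shiftCtx-⟨⟩ zero    x       M zero    = ≈[]
shiftCtx-⟨⟩ zero    x       M (suc y) = ≈M-reflexive (sym (⟨⟩-suc x M y))
shiftCtx-⟨⟩ (suc c) zero    M zero    = ≈M-refl
shiftCtx-⟨⟩ (suc c) zero    M (suc y) = ≈M-trans (shiftCtx-cong c (λ _ → ≈[]) y) (shiftCtx-∅ c y)
shiftCtx-⟨⟩ (suc c) (suc x) M zero    = ≈[]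
shiftCtx-⟨⟩ (suc c) (suc x) M (suc y) =
  ≈M-trans (shiftCtx-cong c (λ z → ≈M-reflexive (⟨⟩-suc x M z)) y)
           (≈M-trans (shiftCtx-⟨⟩ c x M y) (≈M-reflexive (sym (⟨⟩-suc (shiftVar c x) M y))))

Der-shift : ∀ c {Γ t σ m e s} → Der Γ t σ m e s → Der (shiftCtx c Γ) (shift c t) σ m e s
Der-shift c (var-p x) rewrite shift-var c x = conv (≈C-sym (shiftCtx-⟨⟩ c x _)) ≈vr (var-p _)
Der-shift c (val-p x) rewrite shift-var c x = conv (≈C-sym (shiftCtx-∅ c)) ≈vl (val-p _)
Der-shift c (abs-p t)                      = conv (≈C-sym (shiftCtx-∅ c)) ≈vl (abs-p _)
Der-shift c (var-c x M) rewrite shift-var c x = conv (≈C-sym (shiftCtx-⟨⟩ c x M)) ≈T-refl (var-c _ M)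
Der-shift c (app-p {Γ = Γ} {Δ} d₁ h d₂ a) =
  conv (≈C-sym (shiftCtx-+ c Γ Δ)) ≈n (app-p (Der-shift c d₁) h (Der-shift c d₂) a)
Der-shift c (es-p {Γ = Γ} {Δ} d₁ d₂ tight) =
  conv (≈C-sym (shiftCtx-+ c (under Γ) Δ)) ≈T-refl (es-p (Der-shift (suc c) d₁) (Der-shift c d₂) tight)
Der-shift c (app-c {Γ = Γ} {Δ} d₁ d₂) =
  conv (≈C-sym (shiftCtx-+ c Γ Δ)) ≈T-refl (app-c (Der-shift c d₁) (Der-shift c d₂))
Der-shift c (appt-c {Γ = Γ} {Δ} d₁ d₂ tight) =
  conv (≈C-sym (shiftCtx-+ c Γ Δ)) ≈T-refl (appt-c (Der-shift c d₁) (Der-shift c d₂) tight)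
Der-shift c (abs-c Γs τs mᵢ eᵢ sᵢ ds) =
  conv (≈C-sym (shiftCtx-sumC c (λ i → under (Γs i)))) ≈T-refl
       (abs-c (λ i → shiftCtx (suc c) (Γs i)) τs mᵢ eᵢ sᵢ (λ i → Der-shift (suc c) (ds i)))
Der-shift c (es-c {Γ = Γ} {Δ} d₁ d₂) =
  conv (≈C-sym (shiftCtx-+ c (under Γ) Δ)) ≈T-refl (es-c (Der-shift (suc c) d₁) (Der-shift c d₂))
Der-shift c (conv Γ≈Γ' σ≈σ' d) = conv (shiftCtx-cong c Γ≈Γ') σ≈σ' (Der-shift c d)

Der-resp : Γ ≈C Γ' → m ≡ m' → e ≡ e' → s ≡ s' → Der Γ t σ m e s → Der Γ' t σ m' e' s'
Der-resp Γ≈Γ' refl refl refl d = conv Γ≈Γ' ≈T-refl d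

Der-mt-≡ : M ≡ N → Der Γ t (mt M) m e s → Der Γ t (mt N) m e s
Der-mt-≡ refl d = d

-- The premises of abs-c, one at a time, so that they can be permuted along _≈M_.
data Bodies (t : Tm) : Ctx → MTy → ℤ → ℤ → ℤ → Set where
  []   : Bodies t ∅ [] 0ℤ 0ℤ 0ℤ
  cons : ∀ {Γ Δ τ σ K m e s m' e' s'} →
         Der Γ t τ m e s → (Γ 0 ⇒ τ) ≈T σ → Bodies t Δ K m' e' s' →
         Bodies t (under Γ +C Δ) (σ ∷ K) (m + m') (e + e') (s + s')
  conv : Δ ≈C Δ' → Bodies t Δ K m e s → Bodies t Δ' K m e s

Bodies-resp : Δ ≈C Δ' → m ≡ m' → e ≡ e' → s ≡ s' → Bodies t Δ K m e s → Bodies t Δ' K m' e' s'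
Bodies-resp Δ≈Δ' refl refl refl B = conv Δ≈Δ' B

Bodies-fromPremises : (Γs : Fin k → Ctx) (τs : Fin k → Ty) (mᵢ eᵢ sᵢ : Fin k → ℤ) →
  (∀ i → Der (Γs i) t (τs i) (mᵢ i) (eᵢ i) (sᵢ i)) →
  Bodies t (sumC (λ i → under (Γs i))) (tabulate (λ i → Γs i 0 ⇒ τs i)) (sumℤ mᵢ) (sumℤ eᵢ) (sumℤ sᵢ)
Bodies-fromPremises {zero}  Γs τs mᵢ eᵢ sᵢ ds = []
Bodies-fromPremises {suc k} Γs τs mᵢ eᵢ sᵢ ds =
  cons (ds zero) ≈T-refl
    (Bodies-fromPremises (λ i → Γs (suc i)) (λ i → τs (suc i))
       (λ i → mᵢ (suc i)) (λ i → eᵢ (suc i)) (λ i → sᵢ (suc i)) (λ i → ds (suc i)))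

record Premises (t : Tm) (Δ : Ctx) (K : MTy) (m e s : ℤ) : Set where
  constructor premises
  field
    {size}   : ℕ
    Γs       : Fin size → Ctx
    τs       : Fin size → Ty
    mᵢ eᵢ sᵢ : Fin size → ℤ
    ds       : ∀ i → Der (Γs i) t (τs i) (mᵢ i) (eᵢ i) (sᵢ i)
    ctx      : sumC (λ i → under (Γs i)) ≈C Δ
    mtype    : tabulate (λ i → Γs i 0 ⇒ τs i) ≈M K
    m≡       : sumℤ mᵢ ≡ m
    e≡       : sumℤ eᵢ ≡ e
    s≡       : sumℤ sᵢ ≡ s

Bodies-premises : Bodies t Δ K m e s → Premises t Δ K m e s
Bodies-premises [] = premises (λ ()) (λ ()) (λ ()) (λ ()) (λ ()) (λ ()) ≈C-refl ≈[] refl refl refl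
Bodies-premises (cons {Γ = Γ} {τ = τ} {m = m} {e = e} {s = s} d p B) with Bodies-premises B
... | premises Γs τs mᵢ eᵢ sᵢ ds ctx mtype m≡ e≡ s≡ =
  premises (Γ Vec.∷ Γs) (τ Vec.∷ τs) (m Vec.∷ mᵢ) (e Vec.∷ eᵢ) (s Vec.∷ sᵢ)
    (λ { zero → d ; (suc i) → ds i })
    (+C-cong ≈C-refl ctx) (≈ins {N₁ = []} p mtype) (cong (m +_) m≡) (cong (e +_) e≡) (cong (s +_) s≡)
Bodies-premises (conv Δ≈Δ' B) with Bodies-premises B
... | premises Γs τs mᵢ eᵢ sᵢ ds ctx mtype m≡ e≡ s≡ =
  premises Γs τs mᵢ eᵢ sᵢ ds (≈C-trans ctx Δ≈Δ') mtype m≡ e≡ s≡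

Bodies-abs : Bodies t Δ K m e s → Der Δ (lam t) (mt K) m (1ℤ + e) s
Bodies-abs B with Bodies-premises B
... | premises Γs τs mᵢ eᵢ sᵢ ds ctx mtype refl refl refl =
  conv ctx (≈mt mtype) (abs-c Γs τs mᵢ eᵢ sᵢ ds)

Bodies-insert : ∀ N₁ {N₂} → Der Γ t τ m e s → (Γ 0 ⇒ τ) ≈T σ → Bodies t Δ (N₁ ++ N₂) m' e' s' →
                Bodies t (under Γ +C Δ) (N₁ ++ σ ∷ N₂) (m + m') (e + e') (s + s')
Bodies-insert []       d p B = cons d p B
Bodies-insert {Γ = Γ} {m = m} {e = e} {s = s} (_ ∷ N₁) d p
              (cons {Γ = Γ₁} {Δ = Δ₁} {m = m₁} {e = e₁} {s = s₁} d₁ p₁ B) =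
  Bodies-resp (+C-left-comm (under Γ₁) (under Γ) Δ₁)
              (+-left-comm m₁ m _) (+-left-comm e₁ e _) (+-left-comm s₁ s _)
    (cons d₁ p₁ (Bodies-insert N₁ d p B))
Bodies-insert (ν ∷ N₁) d p (conv Δ≈Δ' B) = conv (+C-cong ≈C-refl Δ≈Δ') (Bodies-insert (ν ∷ N₁) d p B)

Bodies-perm : Bodies t Δ K m e s → K ≈M K' → Bodies t Δ K' m e s
Bodies-perm []            ≈[]                       = []
Bodies-perm (cons d p B)  (≈ins {N₁ = N₁} σ≈ρ K≈K') =
  Bodies-insert N₁ d (≈T-trans p σ≈ρ) (Bodies-perm B K≈K')
Bodies-perm (conv Δ≈Δ' B) K≈K'                      = conv Δ≈Δ' (Bodies-perm B K≈K')

lam-inversion : Der Δ (lam t) σ m e s → σ ≈T mt K → Σ[ e₀ ∈ ℤ ] e ≡ 1ℤ + e₀ × Bodies t Δ K m e₀ s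
lam-inversion (abs-c Γs τs mᵢ eᵢ sᵢ ds) (≈mt K≈K') =
  _ , refl , Bodies-perm (Bodies-fromPremises Γs τs mᵢ eᵢ sᵢ ds) K≈K'
lam-inversion (conv Δ≈Δ' σ≈σ' d) σ'≈ with lam-inversion d (≈T-trans σ≈σ' σ'≈)
... | e₀ , e≡ , B = e₀ , e≡ , conv Δ≈Δ' B

var-inversion : ∀ {z} → Der Δ (var z) σ m e s → σ ≈T mt K → Δ ≈C ⟨ z ∶ K ⟩ × m ≡ 0ℤ × e ≡ 1ℤ × s ≡ 0ℤ
var-inversion (var-c z M) (≈mt M≈K) = ⟨⟩-cong z M≈K , refl , refl , refl
var-inversion (conv Δ≈Δ' σ≈σ' d) σ'≈ with var-inversion d (≈T-trans σ≈σ' σ'≈)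
... | Δ≈ , m≡ , e≡ , s≡ = ≈C-trans (≈C-sym Δ≈Δ') Δ≈ , m≡ , e≡ , s≡

Bodies-empty : Bodies t Δ [] m e s → Δ ≈C ∅ × m ≡ 0ℤ × e ≡ 0ℤ × s ≡ 0ℤ
Bodies-empty []            = ≈C-refl , refl , refl , refl
Bodies-empty (conv Δ≈Δ' B) with Bodies-empty B
... | Δ≈∅ , m≡ , e≡ , s≡ = ≈C-trans (≈C-sym Δ≈Δ') Δ≈∅ , m≡ , e≡ , s≡

Bodies-¬vr : Bodies t Δ (tvr ∷ K) m e s → ⊥
Bodies-¬vr (cons d () B)
Bodies-¬vr (conv Δ≈Δ' B) = Bodies-¬vr B

record Split (J : Ctx → MTy → ℤ → ℤ → ℤ → Set) (δ : ℤ) (Δ : Ctx) (M N : MTy) (m e s : ℤ) : Set where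
  constructor split
  field
    {Δ₁ Δ₂}             : Ctx
    {m₁ e₁ s₁ m₂ e₂ s₂} : ℤ
    left                : J Δ₁ M m₁ e₁ s₁
    right               : J Δ₂ N m₂ e₂ s₂
    ctx                 : Δ ≈C (Δ₁ +C Δ₂)
    m≡                  : m ≡ m₁ + m₂
    e≡                  : e ≡ e₁ + e₂ + δ
    s≡                  : s ≡ s₁ + s₂

Bodies-split : ∀ M {N} → Bodies t Δ (M ++ N) m e s → Split (Bodies t) 0ℤ Δ M N m e s
Bodies-split {m = m} {e = e} {s = s} [] B =
  split [] B ≈C-refl (sym (ℤ.+-identityˡ m)) (unit e) (sym (ℤ.+-identityˡ s))
  where
  unit : ∀ a → a ≡ 0ℤ + a + 0ℤ
  unit = solve-∀
Bodies-split (_ ∷ M) (cons {Γ = Γ} {m = m} {e = e} {s = s} d p B) with Bodies-split M B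
... | split {Δ₁ = Δ₁} {Δ₂} {m₁} {e₁} {s₁} {m₂} {e₂} {s₂} B₁ B₂ ctx refl refl refl =
  split (cons d p B₁) B₂ (≈C-trans (+C-cong ≈C-refl ctx) (≈C-sym (+C-assoc (under Γ) Δ₁ Δ₂)))
    (sym (ℤ.+-assoc m m₁ m₂)) (assoc e e₁ e₂) (sym (ℤ.+-assoc s s₁ s₂))
  where
  assoc : ∀ a b c → a + (b + c + 0ℤ) ≡ a + b + c + 0ℤ
  assoc = solve-∀
Bodies-split (_ ∷ M) (conv Δ≈Δ' B) with Bodies-split (_ ∷ M) B
... | split B₁ B₂ ctx m≡ e≡ s≡ = split B₁ B₂ (≈C-trans (≈C-sym Δ≈Δ') ctx) m≡ e≡ s≡

value-split : ∀ {M N} → IsValue v → Der Δ v (mt (M ++ N)) m e s →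
              Split (λ Δ M → Der Δ v (mt M)) (- 1ℤ) Δ M N m e s
value-split {M = M} {N} (val-var z) d with var-inversion d ≈T-refl
... | Δ≈ , refl , refl , refl = split (var-c z M) (var-c z N) (≈C-trans Δ≈ (⟨⟩-++ z M N)) refl refl refl
value-split {M = M} (val-lam t) d with lam-inversion d ≈T-refl
... | e₀ , refl , B with Bodies-split M B
... | split {e₁ = e₁} {e₂ = e₂} B₁ B₂ ctx m≡ refl s≡ =
  split (Bodies-abs B₁) (Bodies-abs B₂) ctx m≡ (regroup e₁ e₂) s≡
  where
  regroup : ∀ a b → 1ℤ + (a + b + 0ℤ) ≡ (1ℤ + a) + (1ℤ + b) + - 1ℤ
  regroup = solve-∀

value-empty : IsValue v → Der Δ v (mt []) m e s → Δ ≈C ∅ × m ≡ 0ℤ × e ≡ 1ℤ × s ≡ 0ℤ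
value-empty (val-var z) d with var-inversion d ≈T-refl
... | Δ≈ , m≡ , e≡ , s≡ = ≈C-trans Δ≈ (⟨⟩-[] z) , m≡ , e≡ , s≡
value-empty (val-lam t) d with lam-inversion d ≈T-refl
... | e₀ , refl , B with Bodies-empty B
... | Δ≈∅ , m≡ , refl , s≡ = Δ≈∅ , m≡ , refl , s≡

value-vr : IsValue v → Der Δ v (mt [ tvr ]) m e s → Der Δ v tvr m (e - 1ℤ) s
value-vr (val-var z) d with var-inversion d ≈T-refl
... | Δ≈ , refl , refl , refl = conv (≈C-sym Δ≈) ≈vr (var-p z)
value-vr (val-lam t) d with lam-inversion d ≈T-refl
... | _ , _ , B = ⊥-elim (Bodies-¬vr B)

value-vl : IsValue v → Der ∅ v tvl 0ℤ 0ℤ 0ℤ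
value-vl (val-var y) = val-p y
value-vl (val-lam t) = abs-p t

record SplitFamily (v : Tm) (Δ : Ctx) (Ms : Fin k → MTy) (m e s : ℤ) : Set where
  constructor splitFamily
  field
    Δs       : Fin k → Ctx
    mᵢ eᵢ sᵢ : Fin k → ℤ
    ds       : ∀ i → Der (Δs i) v (mt (Ms i)) (mᵢ i) (eᵢ i) (sᵢ i)
    ctx      : Δ ≈C sumC Δs
    m≡       : m ≡ sumℤ mᵢ
    e≡       : e ≡ 1ℤ + sumℤ (λ i → eᵢ i - 1ℤ)
    s≡       : s ≡ sumℤ sᵢ

value-splitFamily : (Γs : Fin k → Ctx) (x : ℕ) → IsValue v → Der Δ v (mt (sumC Γs x)) m e s →
                    SplitFamily v Δ (λ i → Γs i x) m e s
value-splitFamily {zero}  Γs x val d with value-empty val d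
... | Δ≈∅ , m≡ , e≡ , s≡ = splitFamily (λ ()) (λ ()) (λ ()) (λ ()) (λ ()) Δ≈∅ m≡ e≡ s≡
value-splitFamily {suc k} Γs x val d with value-split {M = Γs zero x} val d
... | split {m₁ = m₁} {e₁} {s₁} d₁ d₂ ctx refl refl refl
    with value-splitFamily (λ i → Γs (suc i)) x val d₂
... | splitFamily Δs mᵢ eᵢ sᵢ ds ctx′ refl refl refl =
  splitFamily (_ Vec.∷ Δs) (m₁ Vec.∷ mᵢ) (e₁ Vec.∷ eᵢ) (s₁ Vec.∷ sᵢ) (λ { zero → d₁ ; (suc i) → ds i })
    (≈C-trans ctx (+C-cong ≈C-refl ctx′)) refl (regroup e₁ (sumℤ (λ i → eᵢ i - 1ℤ))) refl
  where
  regroup : ∀ a b → a + (1ℤ + b) + - 1ℤ ≡ 1ℤ + ((a - 1ℤ) + b)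
  regroup = solve-∀

sumℤ-cong : ∀ {f g : Fin k → ℤ} → (∀ i → f i ≡ g i) → sumℤ f ≡ sumℤ g
sumℤ-cong {zero}  f≗g = refl
sumℤ-cong {suc k} f≗g = cong₂ _+_ (f≗g zero) (sumℤ-cong (λ i → f≗g (suc i)))

sumℤ-+ : ∀ (f g : Fin k → ℤ) → sumℤ (λ i → f i + g i) ≡ sumℤ f + sumℤ g
sumℤ-+ {zero}  f g = refl
sumℤ-+ {suc k} f g =
  trans (cong (f zero + g zero +_) (sumℤ-+ (λ i → f (suc i)) (λ i → g (suc i))))
        (+-interchange (f zero) (g zero) _ _)

sumC-cong : ∀ {Γs Δs : Fin k → Ctx} → (∀ i → Γs i ≈C Δs i) → sumC Γs ≈C sumC Δs
sumC-cong {zero}  Γs≈Δs = ≈C-refl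
sumC-cong {suc k} Γs≈Δs = +C-cong (Γs≈Δs zero) (sumC-cong (λ i → Γs≈Δs (suc i)))

sumC-+ : ∀ (Γs Δs : Fin k → Ctx) → sumC (λ i → Γs i +C Δs i) ≈C (sumC Γs +C sumC Δs)
sumC-+ {zero}  Γs Δs = ≈C-refl
sumC-+ {suc k} Γs Δs =
  ≈C-trans (+C-cong ≈C-refl (sumC-+ (λ i → Γs (suc i)) (λ i → Δs (suc i))))
           (+C-interchange (Γs zero) (Δs zero) _ _)

sumC-∖∖ : ∀ (Γs : Fin k → Ctx) x → sumC (λ i → Γs i ∖∖ x) ≈C (sumC Γs ∖∖ x)
sumC-∖∖ {zero}  Γs x = ≈C-sym (∖∖-unused ∅ x refl)
sumC-∖∖ {suc k} Γs x =
  ≈C-trans (+C-cong ≈C-refl (sumC-∖∖ (λ i → Γs (suc i)) x)) (≈C-sym (∖∖-+ (Γs zero) _ x))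

record Substitutive (Γ : Ctx) (t : Tm) (τ : Ty) (m e s : ℤ) : Set where
  field
    substitute : ∀ {Δ v m' e' s'} x → IsValue v → Der Δ v (mt (Γ x)) m' e' s' →
                 Der ((Γ ∖∖ x) +C Δ) (sub x v t) τ (m + m') (e + e' - 1ℤ) (s + s')
open Substitutive

substitutive-under : Substitutive Γ t τ m e s →
  ∀ {Δ v m' e' s'} x → IsValue v → Der Δ v (mt (Γ (suc x))) m' e' s' →
  Der ((Γ ∖∖ suc x) +C shiftCtx 0 Δ) (sub (suc x) (shift 0 v) t) τ (m + m') (e + e' - 1ℤ) (s + s')
substitutive-under sub-t x val dv = substitute sub-t (suc x) (shift-value 0 val) (Der-shift 0 dv)

binder-type : ∀ Γ Δ x → ((Γ ∖∖ suc x) +C shiftCtx 0 Δ) 0 ≡ Γ 0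
binder-type Γ Δ x = trans (++-identityʳ _) (∖∖-other Γ (suc x) 0 λ ())

under-binder : ∀ Γ Δ x → under ((Γ ∖∖ suc x) +C shiftCtx 0 Δ) ≈C ((under Γ ∖∖ x) +C Δ)
under-binder Γ Δ x = +C-cong (under-∖∖ Γ x) ≈C-refl

∖∖-+-interchange : ∀ Γ₁ Γ₂ x {Δ Δ₁ Δ₂} → Δ ≈C (Δ₁ +C Δ₂) →
  (((Γ₁ ∖∖ x) +C Δ₁) +C ((Γ₂ ∖∖ x) +C Δ₂)) ≈C (((Γ₁ +C Γ₂) ∖∖ x) +C Δ)
∖∖-+-interchange Γ₁ Γ₂ x Δ≈ =
  ≈C-trans (+C-interchange (Γ₁ ∖∖ x) _ (Γ₂ ∖∖ x) _) (+C-cong (≈C-sym (∖∖-+ Γ₁ Γ₂ x)) (≈C-sym Δ≈))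

substitute-unused : ∀ x → Γ x ≡ [] → IsValue v → Der Δ v (mt (Γ x)) m' e' s' → Der Γ t τ m e s →
                    Der ((Γ ∖∖ x) +C Δ) t τ (m + m') (e + e' - 1ℤ) (s + s')
substitute-unused {Γ = Γ} {m = m} {e = e} {s = s} x Γx≡[] val dv d
  with value-empty val (Der-mt-≡ Γx≡[] dv)
... | Δ≈∅ , refl , refl , refl =
  Der-resp (≈C-trans (≈C-sym (+C-identityʳ Γ)) (+C-cong (≈C-sym (∖∖-unused Γ x Γx≡[])) (≈C-sym Δ≈∅)))
    (sym (ℤ.+-identityʳ m)) (cancel e) (sym (ℤ.+-identityʳ s)) d
  where
  cancel : ∀ a → a ≡ a + 1ℤ - 1ℤ
  cancel = solve-∀

var-p-substitutive : ∀ y → Substitutive ⟨ y ∶ [ tvr ] ⟩ (var y) tvr 0ℤ 0ℤ 0ℤ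
var-p-substitutive y .substitute {e' = e'} x val dv with y ≟ x
... | yes refl =
  Der-resp (≈C-sym (+C-cong (⟨⟩-∖∖ y [ tvr ]) ≈C-refl))
    (sym (ℤ.+-identityˡ _)) (cong (_- 1ℤ) (sym (ℤ.+-identityˡ e'))) (sym (ℤ.+-identityˡ _))
    (value-vr val (Der-mt-≡ (⟨⟩-self y [ tvr ]) dv))
... | no y≢x = substitute-unused x (⟨⟩-other y [ tvr ] x λ x≡y → y≢x (sym x≡y)) val dv (var-p y)

var-c-substitutive : ∀ y M → Substitutive ⟨ y ∶ M ⟩ (var y) (mt M) 0ℤ 1ℤ 0ℤ
var-c-substitutive y M .substitute x val dv with y ≟ x
... | yes refl =
  Der-resp (≈C-sym (+C-cong (⟨⟩-∖∖ y M) ≈C-refl))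
    (sym (ℤ.+-identityˡ _)) (cancel _) (sym (ℤ.+-identityˡ _))
    (Der-mt-≡ (⟨⟩-self y M) dv)
  where
  cancel : ∀ a → a ≡ 1ℤ + a - 1ℤ
  cancel = solve-∀
... | no y≢x = substitute-unused x (⟨⟩-other y M x λ x≡y → y≢x (sym x≡y)) val dv (var-c y M)

val-p-substitutive : ∀ y → Substitutive ∅ (var y) tvl 0ℤ 0ℤ 0ℤ
val-p-substitutive y .substitute x val dv with y ≟ x
... | yes refl = substitute-unused x refl val dv (value-vl val)
... | no  _    = substitute-unused x refl val dv (val-p y)

abs-p-substitutive : ∀ t → Substitutive ∅ (lam t) tvl 0ℤ 0ℤ 0ℤ
abs-p-substitutive t .substitute x val dv = substitute-unused x refl val dv (abs-p _)

conv-substitutive : Γ ≈C Γ' → σ ≈T σ' → Substitutive Γ t σ m e s → Substitutive Γ' t σ' m e s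
conv-substitutive Γ≈Γ' σ≈σ' sub-t .substitute x val dv =
  conv (+C-cong (∖∖-cong x Γ≈Γ') ≈C-refl) σ≈σ'
       (substitute sub-t x val (conv ≈C-refl (≈mt (≈M-sym (Γ≈Γ' x))) dv))

private
  pred-interchange : ∀ a b c d → (a + b - 1ℤ) + (c + d - 1ℤ) ≡ (a + c) + (b + d + - 1ℤ) - 1ℤ
  pred-interchange = solve-∀

  pred-interchange-pred : ∀ a b c d →
    (a + b - 1ℤ) + (c + d - 1ℤ) + - 1ℤ ≡ (a + c + - 1ℤ) + (b + d + - 1ℤ) - 1ℤ
  pred-interchange-pred = solve-∀

  suc-interchange : ∀ a b c d → (a + b) + (c + d) + 1ℤ ≡ (a + c + 1ℤ) + (b + d)
  suc-interchange = solve-∀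

-- The three application rules differ only in their side conditions and in how the counters combine.
app-substitutive : ∀ {Γ₁ Γ₂ t₁ t₂ τ₁ τ₂ τ m₁ e₁ s₁ m₂ e₂ s₂} (M E S : ℤ → ℤ → ℤ) →
  (∀ {Θ₁ Θ₂ u₁ u₂ n₁ f₁ r₁ n₂ f₂ r₂} → Der Θ₁ u₁ τ₁ n₁ f₁ r₁ → Der Θ₂ u₂ τ₂ n₂ f₂ r₂ →
     Der (Θ₁ +C Θ₂) (app u₁ u₂) τ (M n₁ n₂) (E f₁ f₂) (S r₁ r₂)) →
  (∀ a b c d → M (a + b) (c + d) ≡ M a c + (b + d)) →
  (∀ a b c d → E (a + b - 1ℤ) (c + d - 1ℤ) ≡ E a c + (b + d + - 1ℤ) - 1ℤ) →
  (∀ a b c d → S (a + b) (c + d) ≡ S a c + (b + d)) →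
  Substitutive Γ₁ t₁ τ₁ m₁ e₁ s₁ → Substitutive Γ₂ t₂ τ₂ m₂ e₂ s₂ →
  Substitutive (Γ₁ +C Γ₂) (app t₁ t₂) τ (M m₁ m₂) (E e₁ e₂) (S s₁ s₂)
app-substitutive {Γ₁} {Γ₂} {m₁ = m₁} {e₁} {s₁} {m₂} {e₂} {s₂} M E S rule M-additive E-additive S-additive
                 sub₁ sub₂ .substitute x val dv
  with value-split {M = Γ₁ x} val dv
... | split {m₁ = n₁} {f₁} {r₁} {n₂} {f₂} {r₂} dv₁ dv₂ ctx refl refl refl =
  Der-resp (∖∖-+-interchange Γ₁ Γ₂ x ctx)
           (M-additive m₁ n₁ m₂ n₂) (E-additive e₁ f₁ e₂ f₂) (S-additive s₁ r₁ s₂ r₂)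
    (rule (substitute sub₁ x val dv₁) (substitute sub₂ x val dv₂))

es-substitutive : ∀ {Γ₁ Γ₂ t₁ t₂ τ₂ τ m₁ e₁ s₁ m₂ e₂ s₂} →
  (∀ {Θ₁ Θ₂ u₁ u₂ n₁ f₁ r₁ n₂ f₂ r₂} → Θ₁ 0 ≡ Γ₁ 0 → Der Θ₁ u₁ τ n₁ f₁ r₁ → Der Θ₂ u₂ τ₂ n₂ f₂ r₂ →
     Der (under Θ₁ +C Θ₂) (es u₁ u₂) τ (n₁ + n₂) (f₁ + f₂) (r₁ + r₂)) →
  Substitutive Γ₁ t₁ τ m₁ e₁ s₁ → Substitutive Γ₂ t₂ τ₂ m₂ e₂ s₂ →
  Substitutive (under Γ₁ +C Γ₂) (es t₁ t₂) τ (m₁ + m₂) (e₁ + e₂) (s₁ + s₂)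
es-substitutive {Γ₁} {Γ₂} {m₁ = m₁} {e₁} {s₁} {m₂} {e₂} {s₂} rule sub₁ sub₂ .substitute x val dv
  with value-split {M = Γ₁ (suc x)} val dv
... | split {Δ₁ = Δ₁} {m₁ = n₁} {f₁} {r₁} {n₂} {f₂} {r₂} dv₁ dv₂ ctx refl refl refl =
  Der-resp (≈C-trans (+C-cong (under-binder Γ₁ Δ₁ x) ≈C-refl) (∖∖-+-interchange (under Γ₁) Γ₂ x ctx))
    (+-interchange m₁ n₁ m₂ n₂) (pred-interchange e₁ f₁ e₂ f₂) (+-interchange s₁ r₁ s₂ r₂)
    (rule (binder-type Γ₁ Δ₁ x) (substitutive-under sub₁ x val dv₁) (substitute sub₂ x val dv₂))

sumC-binder : ∀ (Γs Δs : Fin k → Ctx) x → Δ ≈C sumC Δs →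
  sumC (λ i → under ((Γs i ∖∖ suc x) +C shiftCtx 0 (Δs i))) ≈C ((sumC (λ i → under (Γs i)) ∖∖ x) +C Δ)
sumC-binder Γs Δs x Δ≈ = begin
  sumC (λ i → under ((Γs i ∖∖ suc x) +C shiftCtx 0 (Δs i)))
    ≈⟨ sumC-cong (λ i → under-binder (Γs i) (Δs i) x) ⟩
  sumC (λ i → (under (Γs i) ∖∖ x) +C Δs i)
    ≈⟨ sumC-+ (λ i → under (Γs i) ∖∖ x) Δs ⟩
  sumC (λ i → under (Γs i) ∖∖ x) +C sumC Δs
    ≈⟨ +C-cong (sumC-∖∖ (λ i → under (Γs i)) x) (≈C-sym Δ≈) ⟩
  (sumC (λ i → under (Γs i)) ∖∖ x) +C _
    ∎
  where open SetoidReasoning (CommutativeMonoid.setoid contexts)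

sumℤ-pred-+ : ∀ (f g : Fin k → ℤ) →
  1ℤ + sumℤ (λ i → f i + g i - 1ℤ) ≡ (1ℤ + sumℤ f) + (1ℤ + sumℤ (λ i → g i - 1ℤ)) - 1ℤ
sumℤ-pred-+ f g = begin
  1ℤ + sumℤ (λ i → f i + g i - 1ℤ)
    ≡⟨ cong (1ℤ +_) (sumℤ-cong (λ i → ℤ.+-assoc (f i) (g i) (- 1ℤ))) ⟩
  1ℤ + sumℤ (λ i → f i + (g i - 1ℤ))
    ≡⟨ cong (1ℤ +_) (sumℤ-+ f (λ i → g i - 1ℤ)) ⟩
  1ℤ + (sumℤ f + sumℤ (λ i → g i - 1ℤ))
    ≡⟨ regroup (sumℤ f) (sumℤ (λ i → g i - 1ℤ)) ⟩
  (1ℤ + sumℤ f) + (1ℤ + sumℤ (λ i → g i - 1ℤ)) - 1ℤ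
    ∎
  where
  open ≡-Reasoning
  regroup : ∀ a b → 1ℤ + (a + b) ≡ (1ℤ + a) + (1ℤ + b) - 1ℤ
  regroup = solve-∀

abs-c-substitutive : ∀ {t} (Γs : Fin k → Ctx) (τs : Fin k → Ty) (mᵢ eᵢ sᵢ : Fin k → ℤ) →
  (∀ i → Substitutive (Γs i) t (τs i) (mᵢ i) (eᵢ i) (sᵢ i)) →
  Substitutive (sumC (λ i → under (Γs i))) (lam t) (mt (tabulate (λ i → Γs i 0 ⇒ τs i)))
               (sumℤ mᵢ) (1ℤ + sumℤ eᵢ) (sumℤ sᵢ)
abs-c-substitutive Γs τs mᵢ eᵢ sᵢ subs .substitute x val dv
  with value-splitFamily (λ i → under (Γs i)) x val dv
... | splitFamily Δs m′ᵢ e′ᵢ s′ᵢ dvs ctx refl refl refl =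
  conv ≈C-refl (≈mt (≈M-reflexive (tabulate-cong (λ i → cong (_⇒ τs i) (binder-type (Γs i) (Δs i) x)))))
    (Der-resp (sumC-binder Γs Δs x ctx) (sumℤ-+ mᵢ m′ᵢ) (sumℤ-pred-+ eᵢ e′ᵢ) (sumℤ-+ sᵢ s′ᵢ)
      (abs-c (λ i → (Γs i ∖∖ suc x) +C shiftCtx 0 (Δs i)) τs
             (λ i → mᵢ i + m′ᵢ i) (λ i → eᵢ i + e′ᵢ i - 1ℤ) (λ i → sᵢ i + s′ᵢ i)
             (λ i → substitutive-under (subs i) x val (dvs i))))

substitutive : ∀ {Γ t τ m e s} → Der Γ t τ m e s → Substitutive Γ t τ m e s
substitutive (var-p y)                 = var-p-substitutive y
substitutive (val-p y)                 = val-p-substitutive y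
substitutive (abs-p t)                 = abs-p-substitutive t
substitutive (var-c y M)               = var-c-substitutive y M
substitutive (app-p d₁ h d₂ a)         =
  app-substitutive _+_ _+_ (λ a b → a + b + 1ℤ) (λ d₁′ d₂′ → app-p d₁′ h d₂′ a)
    +-interchange pred-interchange suc-interchange (substitutive d₁) (substitutive d₂)
substitutive (app-c d₁ d₂)             =
  app-substitutive (λ a b → a + b + 1ℤ) (λ a b → a + b + - 1ℤ) _+_ app-c
    suc-interchange pred-interchange-pred +-interchange (substitutive d₁) (substitutive d₂)
substitutive (appt-c d₁ d₂ tight)      =
  app-substitutive (λ a b → a + b + 1ℤ) (λ a b → a + b + - 1ℤ) _+_ (λ d₁′ d₂′ → appt-c d₁′ d₂′ tight)
    suc-interchange pred-interchange-pred +-interchange (substitutive d₁) (substitutive d₂)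
substitutive (es-p d₁ d₂ tight)        =
  es-substitutive (λ eq d₁′ d₂′ → es-p d₁′ d₂′ (subst TightM (sym eq) tight))
    (substitutive d₁) (substitutive d₂)
substitutive (es-c d₁ d₂)              =
  es-substitutive (λ eq d₁′ d₂′ → es-c d₁′ (Der-mt-≡ (sym eq) d₂′))
    (substitutive d₁) (substitutive d₂)
substitutive (abs-c Γs τs mᵢ eᵢ sᵢ ds) = abs-c-substitutive Γs τs mᵢ eᵢ sᵢ (λ i → substitutive (ds i))
substitutive (conv Γ≈Γ' σ≈σ' d)        = conv-substitutive Γ≈Γ' σ≈σ' (substitutive d)

lemma4p6 : ∀ {Γ Δ : Ctx} {t v : Tm} {τ : Ty} {m e s m' e' s' : ℤ} (x : ℕ) →
           Der Γ t τ m e s → IsValue v → Der Δ v (mt (Γ x)) m' e' s' →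
           Der ((Γ ∖∖ x) +C Δ) (sub x v t) τ (m + m') (e + e' - 1ℤ) (s + s')
lemma4p6 x d = substitute (substitutive d) x
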